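{- Let $n\ge 1$, $A\subseteq[n]$ and $1\le k\le n+1$. If $B\subseteq[n]$, $1\le i\le n+1$, and placing the arrangement $R(B,i)$ on a $2\times 2n$ rectangle directly below the arrangement $R(A,k)$ on a $2\times 2n$ rectangle yields a placement of $2n$ pairwise nonattacking kings on the resulting $4\times 2n$ board, then $B\subseteq A$.
   Context: Two kings attack each other if their cells are distinct and adjacent horizontally, vertically or diagonally. A $2\times 2n$ rectangle has a top and a bottom row and columns $1,\dots,2n$; it is partitioned into $n$ squares of size $2\times 2$, square $j$ consisting of columns $2j-1$ (left column) and $2j$ (right column). For $A\subseteq[n]=\{1,\dots,n\}$ and $1\le k\le n+1$, $R(A,k)$ is the placement of $n$ kings with exactly one king in each square $j$, in the top row of the square iff $j\in A$, and in the left column of the square iff $j<k$ (right column iff $j\ge k$). Every placement of $n$ nonattacking kings on a $2\times 2n$ rectangle is of the form $R(A,k)$. Placing one $2\times 2n$ rectangle directly below another means forming a $4\times 2n$ board whose top two rows are the upper rectangle and bottom two rows the lower one, columns aligned. -}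

module Defs where

open import Data.Nat using (ℕ; zero; suc; _+_; _*_; _≤_; _<_; ∣_-_∣)
open import Data.Nat.Properties using (_<?_)
open import Data.Fin using (Fin; toℕ)
open import Data.Fin.Subset using (Subset; Side; inside; outside)
open import Data.Vec using (lookup)
open import Data.Product using (_×_; _,_)
open import Data.Sum using (_⊎_; inj₁; inj₂)
open import Relation.Nullary using (¬_; yes; no)
open import Relation.Binary.PropositionalEquality using (_≡_; _≢_)

-- A cell of a board: (row, column), both 0-indexed; row 0 is the top row.
Cell : Set
Cell = ℕ × ℕ

row : Cell → ℕ
row (r , _) = r

col : Cell → ℕ
col (_ , c) = c

Attack : Cell → Cell → Set
Attack x y = x ≢ y × ∣ row x - row y ∣ ≤ 1 × ∣ col x - col y ∣ ≤ 1

-- Row (within a 2×2n rectangle) of the king of square j in R(A,k):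
-- top row (0) iff j ∈ A, bottom row (1) otherwise.
rowR : ∀ {n} → Subset n → Fin n → ℕ
rowR A j with lookup A j
... | inside  = 0
... | outside = 1

-- Square j (0-indexed Fin j, i.e. square toℕ j + 1 in the paper's 1-indexing)
-- occupies 0-indexed columns 2·toℕ j (left) and 2·toℕ j + 1 (right).
colR : ∀ {n} → ℕ → Fin n → ℕ
colR k j with suc (toℕ j) <? k
... | yes _ = 2 * toℕ j
... | no  _ = suc (2 * toℕ j)

kingR : ∀ {n} → ℕ → Subset n → ℕ → Fin n → Cell
kingR offset A k j = (offset + rowR A j , colR k j)

-- The 2n kings on the 4×2n board obtained by placing R(B,i) directly below
-- R(A,k): inj₁ j is the king of square j of the upper rectangle (rows 0,1),
-- inj₂ j the king of square j of the lower rectangle (rows 2,3).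
stacked : ∀ {n} → Subset n → ℕ → Subset n → ℕ → Fin n ⊎ Fin n → Cell
stacked A k B i (inj₁ j) = kingR 0 A k j
stacked A k B i (inj₂ j) = kingR 2 B i j

NonAttacking : {I : Set} → (I → Cell) → Set
NonAttacking {I} pos = (p q : I) → p ≢ q → pos p ≢ pos q × ¬ Attack (pos p) (pos q)

-- If j ∈ B but j ∉ A, the king of square j of the upper rectangle sits in its
-- bottom row and the king of square j of the lower rectangle in its top row.
-- These are vertically consecutive rows of the 4×2n board, and both kings lie in
-- the two columns of square j, so they attack each other.
module Submission where

open import Defs
open import Data.Nat using (ℕ; zero; suc; _+_; _*_; _≤_; z≤n; s≤s; ∣_-_∣)
open import Data.Nat.Properties using (_<?_; ∣n-n∣≡0; ∣-∣-comm; 1+n≢n)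
open import Data.Fin using (Fin; toℕ)
open import Data.Fin.Subset using (Subset; _⊆_; inside; outside)
open import Data.Vec using (lookup)
open import Data.Vec.Properties using ([]=⇒lookup; lookup⇒[]=)
open import Data.Sum using (inj₁; inj₂)
open import Data.Product using (_,_; proj₁; proj₂)
open import Relation.Nullary using (yes; no; contradiction)
open import Relation.Binary.PropositionalEquality using (_≡_; refl; sym; cong; subst; subst₂)

data InPair (c : ℕ) : ℕ → Set where
  left  : InPair c c
  right : InPair c (suc c)

∣n-1+n∣≡1 : ∀ n → ∣ n - suc n ∣ ≡ 1
∣n-1+n∣≡1 zero    = refl
∣n-1+n∣≡1 (suc n) = ∣n-1+n∣≡1 n

InPair⇒∣-∣≤1 : ∀ {c a b} → InPair c a → InPair c b → ∣ a - b ∣ ≤ 1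
InPair⇒∣-∣≤1 {c} left  left  rewrite ∣n-n∣≡0 c       = z≤n
InPair⇒∣-∣≤1 {c} left  right rewrite ∣n-1+n∣≡1 c     = s≤s z≤n
InPair⇒∣-∣≤1 {c} right left  rewrite ∣-∣-comm (suc c) c
                                   | ∣n-1+n∣≡1 c     = s≤s z≤n
InPair⇒∣-∣≤1 {c} right right rewrite ∣n-n∣≡0 (suc c) = z≤n

colR-InPair : ∀ {n} (k : ℕ) (j : Fin n) → InPair (2 * toℕ j) (colR k j)
colR-InPair k j with suc (toℕ j) <? k
... | yes _ = left
... | no  _ = right

rowR-inside : ∀ {n} {A : Subset n} {j : Fin n} → lookup A j ≡ inside → rowR A j ≡ 0
rowR-inside eq rewrite eq = refl

rowR-outside : ∀ {n} {A : Subset n} {j : Fin n} → lookup A j ≡ outside → rowR A j ≡ 1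
rowR-outside eq rewrite eq = refl

Attack-verticalNeighbours : ∀ {r c d} → ∣ c - d ∣ ≤ 1 → Attack (r , c) (suc r , d)
Attack-verticalNeighbours {r} c~d =
  (λ eq → 1+n≢n (sym (cong proj₁ eq))) , subst (_≤ 1) (sym (∣n-1+n∣≡1 r)) (s≤s z≤n) , c~d

sameSquare-attack : ∀ {n} {A B : Subset n} {k i : ℕ} {j : Fin n} →
                    lookup A j ≡ outside → lookup B j ≡ inside →
                    Attack (stacked A k B i (inj₁ j)) (stacked A k B i (inj₂ j))
sameSquare-attack {A = A} {B} {k} {i} {j} j∉A j∈B =
  subst₂ (λ r s → Attack (r , colR k j) (s , colR i j))
         (sym (rowR-outside {A = A} j∉A)) (cong (2 +_) (sym (rowR-inside {A = B} j∈B)))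
         (Attack-verticalNeighbours (InPair⇒∣-∣≤1 (colR-InPair k j) (colR-InPair i j)))

lemma2 : (n : ℕ) → 1 ≤ n → (A : Subset n) → (k : ℕ) → 1 ≤ k → k ≤ n + 1 → (B : Subset n) → (i : ℕ) → 1 ≤ i → i ≤ n + 1 → NonAttacking (stacked A k B i) → B ⊆ A
lemma2 n _ A k _ _ B i _ _ nonAttacking {j} j∈B with lookup A j in eqA
... | inside  = lookup⇒[]= j A eqA
... | outside = contradiction (sameSquare-attack {A = A} {B} {k} {i} eqA ([]=⇒lookup j∈B))
                              (proj₂ (nonAttacking (inj₁ j) (inj₂ j) λ ()))
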